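{- Let $M=(E,\mathcal{B})$ be an antisymmetric matroid, $T$ a transversal, and $p,q$ distinct skew pairs. Then none, or at least two, of the three pairs $\{(T\cup p)\setminus q,\ (T\cup q)\setminus p\}$, $\{T,\ T\triangle(p\cup q)\}$, $\{T\triangle p,\ T\triangle q\}$ are contained in $\mathcal{B}$. In particular, if $(T\cup p)\setminus q\in\mathcal{B}\cap\mathcal{A}_n$, then $\{T,T\triangle(p\cup q)\}\subseteq\mathcal{B}$ or $\{T\triangle p,T\triangle q\}\subseteq\mathcal{B}$.
   Context: Let $E=[n]\cup[n]^*$ with involution $i\leftrightarrow i^*$; a skew pair is $\{i,i^*\}$; $\mathcal{T}_n$ (transversals) are $n$-subsets of $E$ with no skew pair, $\mathcal{A}_n$ (almost-transversals) $n$-subsets with exactly one skew pair. An antisymmetric matroid on $E$ is $(E,\mathcal{B})$ with $\mathcal{B}\subseteq\mathcal{T}_n\cup\mathcal{A}_n$ satisfying (B1) $\mathcal{B}\ne\emptyset$; (B2) for $T\in\mathcal{T}_n$ and distinct skew pairs $p,q$, $(T\cup p)\setminus q\in\mathcal{B}$ iff $(T\cup q)\setminus p\in\mathcal{B}$; (Exch) for $B,B'\in\mathcal{B}$ and $e\in B\setminus B'$ with $B\setminus\{e\}$ having no skew pair and $B'\cup\{e\}$ having exactly one skew pair, there is $f\in B'\setminus B$ with both $(B\setminus\{e\})\cup\{f\}$ and $(B'\cup\{e\})\setminus\{f\}$ in $\mathcal{B}$. -}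

module Defs where

open import Data.Nat using (ℕ; zero; suc; _+_)
open import Data.Bool using (Bool; true; false; _∧_; _∨_; not; _xor_)
open import Data.Fin using (Fin; zero; suc)
open import Data.Fin.Properties using () renaming (_≟_ to _≟F_)
open import Data.Vec using (Vec; []; _∷_; zipWith; map; lookup; tabulate; foldr)
open import Data.Product using (Σ; _×_; _,_; proj₁; proj₂)
open import Data.Sum using (_⊎_)
open import Relation.Nullary using (¬_; yes; no)
open import Relation.Binary.PropositionalEquality using (_≡_; _≢_)

-- Ground set E = [n] ∪ [n]*.  An element is (i , b) with i : Fin n;
-- b = false means i, b = true means i*.  The involution flips b.
Elt : ℕ → Set
Elt n = Fin n × Bool

-- A subset of E, stored canonically: entry i = (i ∈ S , i* ∈ S).
Sub : ℕ → Set
Sub n = Vec (Bool × Bool) n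

pick : Bool → Bool × Bool → Bool
pick false (a , _) = a
pick true  (_ , b) = b

_∈E_ : {n : ℕ} → Elt n → Sub n → Set
(i , b) ∈E S = pick b (lookup S i) ≡ true

bit : Bool → ℕ
bit true  = 1
bit false = 0

size : {n : ℕ} → Sub n → ℕ
size = foldr _ (λ { (a , b) k → bit a + bit b + k }) 0

skewCount : {n : ℕ} → Sub n → ℕ
skewCount = foldr _ (λ { (a , b) k → bit (a ∧ b) + k }) 0

_∪_ : {n : ℕ} → Sub n → Sub n → Sub n
_∪_ = zipWith (λ { (a , b) (c , d) → (a ∨ c , b ∨ d) })

_∖_ : {n : ℕ} → Sub n → Sub n → Sub n
_∖_ = zipWith (λ { (a , b) (c , d) → (a ∧ not c , b ∧ not d) })

_△_ : {n : ℕ} → Sub n → Sub n → Sub n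
_△_ = zipWith (λ { (a , b) (c , d) → (a xor c , b xor d) })

⟦_⟧ : {n : ℕ} → Elt n → Sub n
⟦ (i , b) ⟧ = tabulate (λ j → f j)
  where
  f : _ → Bool × Bool
  f j with j ≟F i
  ... | yes _ = (not b , b)
  ... | no  _ = (false , false)

skewPair : {n : ℕ} → Fin n → Sub n
skewPair i = tabulate (λ j → f j)
  where
  f : _ → Bool × Bool
  f j with j ≟F i
  ... | yes _ = (true , true)
  ... | no  _ = (false , false)

IsTransversal : {n : ℕ} → Sub n → Set
IsTransversal {n} S = size S ≡ n × skewCount S ≡ 0

IsAlmostTransversal : {n : ℕ} → Sub n → Set
IsAlmostTransversal {n} S = size S ≡ n × skewCount S ≡ 1

record AntisymmetricMatroid (n : ℕ) : Set₁ where
  field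
    ℬ : Sub n → Set
    ℬ⊆𝒯∪𝒜 : ∀ B → ℬ B → IsTransversal B ⊎ IsAlmostTransversal B
    B1 : Σ (Sub n) ℬ
    B2 : ∀ (T : Sub n) (i j : Fin n) → IsTransversal T → i ≢ j →
           (ℬ ((T ∪ skewPair i) ∖ skewPair j) → ℬ ((T ∪ skewPair j) ∖ skewPair i)) ×
           (ℬ ((T ∪ skewPair j) ∖ skewPair i) → ℬ ((T ∪ skewPair i) ∖ skewPair j))
    Exch : ∀ (B B' : Sub n) (e : Elt n) → ℬ B → ℬ B' →
           e ∈E B → ¬ (e ∈E B') →
           skewCount (B ∖ ⟦ e ⟧) ≡ 0 → skewCount (B' ∪ ⟦ e ⟧) ≡ 1 →
           Σ (Elt n) λ f → f ∈E B' × ¬ (f ∈E B) ×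
             ℬ ((B ∖ ⟦ e ⟧) ∪ ⟦ f ⟧) × ℬ ((B' ∪ ⟦ e ⟧) ∖ ⟦ f ⟧)

{-# OPTIONS --safe #-}
module Submission where

-- All six sets agree with T off the coordinates i and j, so only their traces on
-- {i, i*, j, j*} matter.  Swapping k and k* (for k = i, j) where T contains k*,
-- these traces become subsets of a two-element ground set {1, 2, 1*, 2*} in which T
-- is {1, 2}, and the sets of ℬ of this shape again satisfy the exchange axiom.
-- Each implication is then one exchange, computed in the two-element model: from
-- (T ∪ p) ∖ q and (T ∪ q) ∖ p, exchange 1 out of the first; the partner is 2 or 2*,
-- giving {T △ p, T △ q} or {T, T △ (p ∪ q)}.

open import Defs
open import Data.Bool using (Bool; true; false; not; _∧_; _xor_)
open import Data.Bool.Properties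
  using (∧-comm; ∧-identityʳ; ∨-identityʳ; xor-identityʳ; xor-assoc; xor-same)
open import Data.Empty using (⊥-elim)
open import Data.Fin using (Fin; zero; suc)
open import Data.Fin.Properties using (_≟_)
open import Data.Nat using (ℕ; suc; _+_; _≤_; z≤n; s≤s)
open import Data.Nat.Properties
  using (+-commutativeSemigroup; m+n≡0⇒m≡0; m+n≡0⇒n≡0; m≤n⇒m≤1+n; n≮n; suc-injective)
open import Algebra.Properties.CommutativeSemigroup +-commutativeSemigroup using (x∙yz≈y∙xz)
open import Data.Product using (Σ; _×_; _,_; proj₁; proj₂; swap)
open import Data.Sum using (_⊎_; inj₁; inj₂)
open import Data.Vec using (Vec; []; _∷_; lookup; replicate; zipWith; _[_]≔_)
open import Data.Vec.Properties
  using ( lookup∘tabulate; lookup∘update; lookup∘update′; lookup-replicate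
        ; []≔-lookup; []≔-idempotent; []≔-commutes; zipWith-identityʳ)
open import Data.Vec.Relation.Binary.Pointwise.Extensional using (ext; Pointwise-≡⇒≡)
open import Function.Base using (id; _∘_; _∋_)
open import Relation.Nullary using (¬_; yes; no)
open import Relation.Binary.PropositionalEquality
  using (_≡_; _≢_; refl; sym; trans; cong; cong₂; subst; module ≡-Reasoning)

open ≡-Reasoning

Entry : Set
Entry = Bool × Bool

single : Bool → Entry
single b = (not b , b)

reorient : Bool → Entry → Entry
reorient false = id
reorient true  = swap

isSkew : Entry → Bool
isSkew (a , b) = a ∧ b

reorient-diagonal : ∀ o a → reorient o (a , a) ≡ (a , a)
reorient-diagonal false a = refl
reorient-diagonal true  a = refl

reorient-single : ∀ o s → reorient o (single s) ≡ single (s xor o)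
reorient-single false false = refl
reorient-single false true  = refl
reorient-single true  false = refl
reorient-single true  true  = refl

isSkew-reorient : ∀ o x → isSkew (reorient o x) ≡ isSkew x
isSkew-reorient false x       = refl
isSkew-reorient true  (a , b) = ∧-comm b a

pick-reorient : ∀ o s x → pick (s xor o) (reorient o x) ≡ pick s x
pick-reorient false false x = refl
pick-reorient false true  x = refl
pick-reorient true  false x = refl
pick-reorient true  true  x = refl

xor-cancelʳ : ∀ b o → (b xor o) xor o ≡ b
xor-cancelʳ b o = trans (xor-assoc b o o) (trans (cong (b xor_) (xor-same o)) (xor-identityʳ b))

∅ : ∀ {m} → Sub m
∅ = replicate _ (false , false)

-- The entry functions of ⟦_⟧ and skewPair are local to Defs; binding the
-- lookup∘tabulate equation first lets the following  with l ≟ k  unfold them.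
lookup-⟦⟧ : ∀ {m} (k : Fin m) b l → lookup ⟦ (k , b) ⟧ l ≡ lookup (∅ [ k ]≔ single b) l
lookup-⟦⟧ k b l with (lookup ⟦ (k , b) ⟧ l ≡ _) ∋ lookup∘tabulate _ l
... | entry with l ≟ k
... | yes refl = trans entry (sym (lookup∘update k ∅ (single b)))
... | no l≢k   = trans entry (sym (trans (lookup∘update′ l≢k ∅ (single b)) (lookup-replicate l _)))

lookup-skewPair : ∀ {m} (k l : Fin m) → lookup (skewPair k) l ≡ lookup (∅ [ k ]≔ (true , true)) l
lookup-skewPair k l with (lookup (skewPair k) l ≡ _) ∋ lookup∘tabulate _ l
... | entry with l ≟ k
... | yes refl = trans entry (sym (lookup∘update k ∅ (true , true)))
... | no l≢k   = trans entry (sym (trans (lookup∘update′ l≢k ∅ (true , true)) (lookup-replicate l _)))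

⟦⟧≡update : ∀ {m} (k : Fin m) b → ⟦ (k , b) ⟧ ≡ ∅ [ k ]≔ single b
⟦⟧≡update k b = Pointwise-≡⇒≡ (ext (lookup-⟦⟧ k b))

skewPair≡update : ∀ {m} (k : Fin m) → skewPair k ≡ ∅ [ k ]≔ (true , true)
skewPair≡update k = Pointwise-≡⇒≡ (ext (lookup-skewPair k))

zipWith-[]≔ : ∀ {A B C : Set} {m} (f : A → B → C) (xs : Vec A m) (ys : Vec B m) k x y →
              zipWith f (xs [ k ]≔ x) (ys [ k ]≔ y) ≡ zipWith f xs ys [ k ]≔ f x y
zipWith-[]≔ f (_ ∷ xs) (_ ∷ ys) zero    x y = refl
zipWith-[]≔ f (u ∷ xs) (v ∷ ys) (suc k) x y = cong (f u v ∷_) (zipWith-[]≔ f xs ys k x y)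

bit≡0⇒false : ∀ b → bit b ≡ 0 → b ≡ false
bit≡0⇒false false _ = refl

skewCount≡0⇒¬isSkew : ∀ {m} (S : Sub m) → skewCount S ≡ 0 → ∀ k → isSkew (lookup S k) ≡ false
skewCount≡0⇒¬isSkew (x ∷ S) none zero    = bit≡0⇒false _ (m+n≡0⇒m≡0 _ none)
skewCount≡0⇒¬isSkew (x ∷ S) none (suc k) = skewCount≡0⇒¬isSkew S (m+n≡0⇒n≡0 _ none) k

skewCount-[]≔ : ∀ {m} (S : Sub m) k x → isSkew (lookup S k) ≡ false →
                skewCount (S [ k ]≔ x) ≡ bit (isSkew x) + skewCount S
skewCount-[]≔ (y ∷ S) zero    x ¬skew = cong (λ b → bit (isSkew x) + (bit b + skewCount S)) (sym ¬skew)
skewCount-[]≔ (y ∷ S) (suc k) x ¬skew =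
  trans (cong (bit (isSkew y) +_) (skewCount-[]≔ S k x ¬skew))
        (x∙yz≈y∙xz (bit (isSkew y)) (bit (isSkew x)) (skewCount S))

size≤length : ∀ {m} (S : Sub m) → skewCount S ≡ 0 → size S ≤ m
size≤length []                    _    = z≤n
size≤length ((false , false) ∷ S) none = m≤n⇒m≤1+n (size≤length S none)
size≤length ((true  , false) ∷ S) none = s≤s (size≤length S none)
size≤length ((false , true)  ∷ S) none = s≤s (size≤length S none)

transversal-single : ∀ {m} (S : Sub m) → IsTransversal S → ∀ k → Σ Bool λ b → lookup S k ≡ single b
transversal-single ((true , true) ∷ S) (_ , ())
transversal-single {suc m} ((false , false) ∷ S) (full , none) k =
  ⊥-elim (n≮n m (subst (_≤ m) full (size≤length S none)))
transversal-single ((true  , false) ∷ S) _ zero = false , refl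
transversal-single ((false , true)  ∷ S) _ zero = true , refl
transversal-single ((true  , false) ∷ S) (full , none) (suc k) = transversal-single S (suc-injective full , none) k
transversal-single ((false , true)  ∷ S) (full , none) (suc k) = transversal-single S (suc-injective full , none) k

Exchange : ∀ {m} → (Sub m → Set) → Set
Exchange {m} ℬ =
  ∀ (B B' : Sub m) (e : Elt m) → ℬ B → ℬ B' →
  e ∈E B → ¬ (e ∈E B') →
  skewCount (B ∖ ⟦ e ⟧) ≡ 0 → skewCount (B' ∪ ⟦ e ⟧) ≡ 1 →
  Σ (Elt m) λ f → f ∈E B' × ¬ (f ∈E B) ×
    ℬ ((B ∖ ⟦ e ⟧) ∪ ⟦ f ⟧) × ℬ ((B' ∪ ⟦ e ⟧) ∖ ⟦ f ⟧)

NoneOrTwo : Set → Set → Set → Set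
NoneOrTwo P₁ P₂ P₃ = (P₁ → P₂ ⊎ P₃) × (P₂ → P₁ ⊎ P₃) × (P₃ → P₁ ⊎ P₂)

NoneOrTwo-cong : ∀ {P₁ P₂ P₃ Q₁ Q₂ Q₃} → P₁ ≡ Q₁ → P₂ ≡ Q₂ → P₃ ≡ Q₃ →
                 NoneOrTwo P₁ P₂ P₃ → NoneOrTwo Q₁ Q₂ Q₃
NoneOrTwo-cong refl refl refl h = h

Pair₁ Pair₂ Pair₃ : ∀ {m} → (Sub m → Set) → Sub m → Sub m → Sub m → Set
Pair₁ ℬ T p q = ℬ ((T ∪ p) ∖ q) × ℬ ((T ∪ q) ∖ p)
Pair₂ ℬ T p q = ℬ T × ℬ (T △ (p ∪ q))
Pair₃ ℬ T p q = ℬ (T △ p) × ℬ (T △ q)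

NoneOrTwoPairs : ∀ {m} → (Sub m → Set) → Sub m → Sub m → Sub m → Set
NoneOrTwoPairs ℬ T p q = NoneOrTwo (Pair₁ ℬ T p q) (Pair₂ ℬ T p q) (Pair₃ ℬ T p q)

unstarred : Sub 2
unstarred = single false ∷ single false ∷ []

noneOrTwo-unstarred : ∀ {β : Sub 2 → Set} → Exchange β →
                      NoneOrTwoPairs β unstarred (skewPair zero) (skewPair (suc zero))
noneOrTwo-unstarred {β} exch = fromPair₁ , fromPair₂ , fromPair₃
  where
  -- All sets here are closed terms: the side conditions of the exchange hold by
  -- computation, and a candidate partner outside B' ∖ B is refuted by an absurd pattern.
  P₁ P₂ P₃ : Set
  P₁ = Pair₁ β unstarred (skewPair zero) (skewPair (suc zero))
  P₂ = Pair₂ β unstarred (skewPair zero) (skewPair (suc zero))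
  P₃ = Pair₃ β unstarred (skewPair zero) (skewPair (suc zero))

  fromPair₁ : P₁ → P₂ ⊎ P₃
  fromPair₁ (X , Y) with exch _ _ (zero , false) X Y refl (λ ()) refl refl
  ... | (zero     , false) , () , _
  ... | (zero     , true)  , () , _
  ... | (suc zero , false) , _ , _ , Tp , Tq = inj₂ (Tp , Tq)
  ... | (suc zero , true)  , _ , _ , T₂ , T  = inj₁ (T , T₂)

  fromPair₂ : P₂ → P₁ ⊎ P₃
  fromPair₂ (T , T₂) with exch _ _ (zero , false) T T₂ refl (λ ()) refl refl
  ... | (zero     , false) , () , _
  ... | (zero     , true)  , _ , _ , Tp , Tq = inj₂ (Tp , Tq)
  ... | (suc zero , false) , () , _
  ... | (suc zero , true)  , _ , _ , Y , X   = inj₁ (X , Y)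

  fromPair₃ : P₃ → P₁ ⊎ P₂
  fromPair₃ (Tp , Tq) with exch _ _ (zero , true) Tp Tq refl (λ ()) refl refl
  ... | (zero     , false) , _ , _ , T , T₂ = inj₂ (T , T₂)
  ... | (zero     , true)  , () , _
  ... | (suc zero , false) , () , _
  ... | (suc zero , true)  , _ , _ , Y , X  = inj₁ (X , Y)

-- embed R w agrees with R off {i, j} and has the entries of w at i and j, where the
-- orientation bits c and d exchange k and k* for k = i, j.  So a transversal T is
-- embed T unstarred, with c and d recording whether T contains i* and j*.
module Embedding {n} {i j : Fin n} (i≢j : i ≢ j) (c d : Bool) where

  pos : Fin 2 → Fin n
  pos zero       = i
  pos (suc zero) = j

  ori : Fin 2 → Bool
  ori zero       = c
  ori (suc zero) = d

  embed : Sub n → Sub 2 → Sub n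
  embed R (x ∷ y ∷ []) = R [ j ]≔ reorient d y [ i ]≔ reorient c x

  ι : Elt 2 → Elt n
  ι (k , s) = (pos k , s xor ori k)

  lookup-embed-pos : ∀ R w k → lookup (embed R w) (pos k) ≡ reorient (ori k) (lookup w k)
  lookup-embed-pos R (x ∷ y ∷ []) zero       = lookup∘update i (R [ j ]≔ reorient d y) (reorient c x)
  lookup-embed-pos R (x ∷ y ∷ []) (suc zero) =
    trans (lookup∘update′ (i≢j ∘ sym) (R [ j ]≔ reorient d y) (reorient c x)) (lookup∘update j R (reorient d y))

  lookup-embed-off : ∀ R w {k} → k ≢ i → k ≢ j → lookup (embed R w) k ≡ lookup R k
  lookup-embed-off R (x ∷ y ∷ []) k≢i k≢j =
    trans (lookup∘update′ k≢i (R [ j ]≔ reorient d y) (reorient c x)) (lookup∘update′ k≢j R (reorient d y))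

  embed-lookup : ∀ R x y → lookup R i ≡ reorient c x → lookup R j ≡ reorient d y →
                 R ≡ embed R (x ∷ y ∷ [])
  embed-lookup R x y atI atJ = begin
    R                                       ≡⟨ sym ([]≔-lookup R i) ⟩
    R [ i ]≔ lookup R i                     ≡⟨ cong (_[ i ]≔ lookup R i) (sym ([]≔-lookup R j)) ⟩
    R [ j ]≔ lookup R j [ i ]≔ lookup R i   ≡⟨ cong₂ (λ a b → R [ j ]≔ b [ i ]≔ a) atI atJ ⟩
    embed R (x ∷ y ∷ [])                    ∎

  embed-unstarred : ∀ R → lookup R i ≡ single c → lookup R j ≡ single d → R ≡ embed R unstarred
  embed-unstarred R atI atJ =
    embed-lookup R _ _ (trans atI (sym (reorient-single c false))) (trans atJ (sym (reorient-single d false)))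

  embed-∅ : ∅ ≡ embed ∅ ∅
  embed-∅ = embed-lookup ∅ _ _ (trans (lookup-replicate i _) (sym (reorient-diagonal c false)))
                               (trans (lookup-replicate j _) (sym (reorient-diagonal d false)))

  embed-[]≔ : ∀ R w k a → embed R w [ pos k ]≔ reorient (ori k) a ≡ embed R (w [ k ]≔ a)
  embed-[]≔ R (x ∷ y ∷ []) zero       a = []≔-idempotent _ i
  embed-[]≔ R (x ∷ y ∷ []) (suc zero) a =
    trans ([]≔-commutes _ i j i≢j) (cong (_[ i ]≔ reorient c x) ([]≔-idempotent R j))

  ∅[]≔-embed : ∀ k a → ∅ [ pos k ]≔ reorient (ori k) a ≡ embed ∅ (∅ [ k ]≔ a)
  ∅[]≔-embed k a = trans (cong (_[ pos k ]≔ reorient (ori k) a) embed-∅) (embed-[]≔ ∅ ∅ k a)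

  ⟦ι⟧-embed : ∀ x → ⟦ ι x ⟧ ≡ embed ∅ ⟦ x ⟧
  ⟦ι⟧-embed (k , s) = begin
    ⟦ (pos k , s xor ori k) ⟧                 ≡⟨ ⟦⟧≡update (pos k) _ ⟩
    ∅ [ pos k ]≔ single (s xor ori k)         ≡⟨ cong (∅ [ pos k ]≔_) (sym (reorient-single (ori k) s)) ⟩
    ∅ [ pos k ]≔ reorient (ori k) (single s)  ≡⟨ ∅[]≔-embed k (single s) ⟩
    embed ∅ (∅ [ k ]≔ single s)               ≡⟨ cong (embed ∅) (sym (⟦⟧≡update k s)) ⟩
    embed ∅ ⟦ (k , s) ⟧                       ∎

  skewPair-embed : ∀ k → skewPair (pos k) ≡ embed ∅ (skewPair k)
  skewPair-embed k = begin
    skewPair (pos k)                              ≡⟨ skewPair≡update (pos k) ⟩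
    ∅ [ pos k ]≔ (true , true)                    ≡⟨ cong (∅ [ pos k ]≔_) (sym (reorient-diagonal (ori k) true)) ⟩
    ∅ [ pos k ]≔ reorient (ori k) (true , true)   ≡⟨ ∅[]≔-embed k (true , true) ⟩
    embed ∅ (∅ [ k ]≔ (true , true))              ≡⟨ cong (embed ∅) (sym (skewPair≡update k)) ⟩
    embed ∅ (skewPair k)                          ∎

  embed-zipWith : ∀ {g : Entry → Entry → Entry} →
                  (∀ x → g x (false , false) ≡ x) →
                  (∀ o x y → reorient o (g x y) ≡ g (reorient o x) (reorient o y)) →
                  ∀ R w z → embed R (zipWith g w z) ≡ zipWith g (embed R w) (embed ∅ z)
  embed-zipWith {g} identityʳ reorient-g R (x ∷ y ∷ []) (x′ ∷ y′ ∷ []) = begin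
    R [ j ]≔ reorient d (g y y′) [ i ]≔ reorient c (g x x′)
      ≡⟨ cong₂ (λ S a → S [ i ]≔ a)
               (cong₂ (λ S b → S [ j ]≔ b) (sym (zipWith-identityʳ identityʳ R)) (reorient-g d y y′))
               (reorient-g c x x′) ⟩
    zipWith g R ∅ [ j ]≔ g (reorient d y) (reorient d y′) [ i ]≔ g (reorient c x) (reorient c x′)
      ≡⟨ cong (_[ i ]≔ _) (sym (zipWith-[]≔ g R ∅ j _ _)) ⟩
    zipWith g (R [ j ]≔ reorient d y) (∅ [ j ]≔ reorient d y′) [ i ]≔ g (reorient c x) (reorient c x′)
      ≡⟨ sym (zipWith-[]≔ g _ _ i _ _) ⟩
    zipWith g (embed R (x ∷ y ∷ [])) (embed ∅ (x′ ∷ y′ ∷ []))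
      ∎

  embed-∪ : ∀ R w z → embed R (w ∪ z) ≡ embed R w ∪ embed ∅ z
  embed-∪ = embed-zipWith (λ _ → cong₂ _,_ (∨-identityʳ _) (∨-identityʳ _))
                          (λ { false _ _ → refl ; true _ _ → refl })

  embed-∖ : ∀ R w z → embed R (w ∖ z) ≡ embed R w ∖ embed ∅ z
  embed-∖ = embed-zipWith (λ _ → cong₂ _,_ (∧-identityʳ _) (∧-identityʳ _))
                          (λ { false _ _ → refl ; true _ _ → refl })

  embed-△ : ∀ R w z → embed R (w △ z) ≡ embed R w △ embed ∅ z
  embed-△ = embed-zipWith (λ _ → cong₂ _,_ (xor-identityʳ _) (xor-identityʳ _))
                          (λ { false _ _ → refl ; true _ _ → refl })

  pick-embed : ∀ R w k s → pick (s xor ori k) (lookup (embed R w) (pos k)) ≡ pick s (lookup w k)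
  pick-embed R w k s =
    trans (cong (pick (s xor ori k)) (lookup-embed-pos R w k)) (pick-reorient (ori k) s (lookup w k))

  ∈-embed⁺ : ∀ R w x → x ∈E w → ι x ∈E embed R w
  ∈-embed⁺ R w (k , s) x∈w = trans (pick-embed R w k s) x∈w

  ∈-embed⁻ : ∀ R w x → ι x ∈E embed R w → x ∈E w
  ∈-embed⁻ R w (k , s) ιx∈ = trans (sym (pick-embed R w k s)) ιx∈

  difference-in-image : ∀ R w w′ f → f ∈E embed R w′ → ¬ (f ∈E embed R w) → Σ (Elt 2) λ x → f ≡ ι x
  difference-in-image R w w′ (k , b) f∈ f∉ with k ≟ i | k ≟ j
  ... | yes refl | _        = (zero , b xor c) , cong (i ,_) (sym (xor-cancelʳ b c))
  ... | no _     | yes refl = (suc zero , b xor d) , cong (j ,_) (sym (xor-cancelʳ b d))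
  ... | no k≢i   | no k≢j   = ⊥-elim (f∉ (subst (λ e → pick b e ≡ true) same-entry f∈))
    where
    same-entry : lookup (embed R w′) k ≡ lookup (embed R w) k
    same-entry = trans (lookup-embed-off R w′ k≢i k≢j) (sym (lookup-embed-off R w k≢i k≢j))

  skewCount-embed : ∀ R w → skewCount R ≡ 0 → skewCount (embed R w) ≡ skewCount w
  skewCount-embed R (x ∷ y ∷ []) none = begin
    skewCount (R [ j ]≔ reorient d y [ i ]≔ reorient c x)
      ≡⟨ skewCount-[]≔ (R [ j ]≔ reorient d y) i (reorient c x)
                       (trans (cong isSkew (lookup∘update′ i≢j R (reorient d y))) (¬skew i)) ⟩
    bit (isSkew (reorient c x)) + skewCount (R [ j ]≔ reorient d y)
      ≡⟨ cong (bit (isSkew (reorient c x)) +_) (skewCount-[]≔ R j (reorient d y) (¬skew j)) ⟩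
    bit (isSkew (reorient c x)) + (bit (isSkew (reorient d y)) + skewCount R)
      ≡⟨ cong₂ (λ a b → bit a + (bit b + skewCount R)) (isSkew-reorient c x) (isSkew-reorient d y) ⟩
    bit (isSkew x) + (bit (isSkew y) + skewCount R)
      ≡⟨ cong (λ s → bit (isSkew x) + (bit (isSkew y) + s)) none ⟩
    skewCount (x ∷ y ∷ [])
      ∎
    where
    ¬skew = skewCount≡0⇒¬isSkew R none

  embed-∪-⟦⟧ : ∀ R w x → embed R (w ∪ ⟦ x ⟧) ≡ embed R w ∪ ⟦ ι x ⟧
  embed-∪-⟦⟧ R w x = trans (embed-∪ R w ⟦ x ⟧) (cong (embed R w ∪_) (sym (⟦ι⟧-embed x)))

  embed-∖-⟦⟧ : ∀ R w x → embed R (w ∖ ⟦ x ⟧) ≡ embed R w ∖ ⟦ ι x ⟧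
  embed-∖-⟦⟧ R w x = trans (embed-∖ R w ⟦ x ⟧) (cong (embed R w ∖_) (sym (⟦ι⟧-embed x)))

  exchange-embed : ∀ {ℬ : Sub n → Set} R → skewCount R ≡ 0 → Exchange ℬ → Exchange (λ w → ℬ (embed R w))
  exchange-embed {ℬ} R none exch w w′ x w∈ℬ w′∈ℬ x∈w x∉w′ skew₀ skew₁
    with exch (embed R w) (embed R w′) (ι x) w∈ℬ w′∈ℬ (∈-embed⁺ R w x x∈w) (x∉w′ ∘ ∈-embed⁻ R w′ x)
              (trans (cong skewCount (sym (embed-∖-⟦⟧ R w x))) (trans (skewCount-embed R (w ∖ ⟦ x ⟧) none) skew₀))
              (trans (cong skewCount (sym (embed-∪-⟦⟧ R w′ x))) (trans (skewCount-embed R (w′ ∪ ⟦ x ⟧) none) skew₁))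
  ... | f , f∈w′ , f∉w , B₁ , B₂ with difference-in-image R w w′ f f∈w′ f∉w
  ... | y , refl =
    y , ∈-embed⁻ R w′ y f∈w′ , f∉w ∘ ∈-embed⁺ R w y ,
    subst ℬ (sym (trans (embed-∪-⟦⟧ R (w ∖ ⟦ x ⟧) y) (cong (_∪ ⟦ ι y ⟧) (embed-∖-⟦⟧ R w x)))) B₁ ,
    subst ℬ (sym (trans (embed-∖-⟦⟧ R (w′ ∪ ⟦ x ⟧) y) (cong (_∖ ⟦ ι y ⟧) (embed-∪-⟦⟧ R w′ x)))) B₂

  noneOrTwo-embed : ∀ {ℬ : Sub n → Set} R τ π κ {T p q} →
                    T ≡ embed R τ → p ≡ embed ∅ π → q ≡ embed ∅ κ →
                    NoneOrTwoPairs (λ w → ℬ (embed R w)) τ π κ → NoneOrTwoPairs ℬ T p q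
  noneOrTwo-embed {ℬ} R τ π κ refl refl refl =
    NoneOrTwo-cong (cong₂ _×_ (cong ℬ (embed-∪∖ π κ)) (cong ℬ (embed-∪∖ κ π)))
                   (cong (ℬ (embed R τ) ×_) (cong ℬ embed-△∪))
                   (cong₂ _×_ (cong ℬ (embed-△ R τ π)) (cong ℬ (embed-△ R τ κ)))
    where
    embed-∪∖ : ∀ π κ → embed R ((τ ∪ π) ∖ κ) ≡ (embed R τ ∪ embed ∅ π) ∖ embed ∅ κ
    embed-∪∖ π κ = trans (embed-∖ R (τ ∪ π) κ) (cong (_∖ embed ∅ κ) (embed-∪ R τ π))

    embed-△∪ : embed R (τ △ (π ∪ κ)) ≡ embed R τ △ (embed ∅ π ∪ embed ∅ κ)
    embed-△∪ = trans (embed-△ R τ (π ∪ κ)) (cong (embed R τ △_) (embed-∪ ∅ π κ))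

lemma3p2 : ∀ {n : ℕ} (M : AntisymmetricMatroid n) (T : Sub n) (i j : Fin n) →
    IsTransversal T → i ≢ j →
    let open AntisymmetricMatroid M
        p = skewPair i
        q = skewPair j
        P₁ = ℬ ((T ∪ p) ∖ q) × ℬ ((T ∪ q) ∖ p)
        P₂ = ℬ T × ℬ (T △ (p ∪ q))
        P₃ = ℬ (T △ p) × ℬ (T △ q)
    in ((P₁ → P₂ ⊎ P₃) × (P₂ → P₁ ⊎ P₃) × (P₃ → P₁ ⊎ P₂)) ×
       (ℬ ((T ∪ p) ∖ q) → IsAlmostTransversal ((T ∪ p) ∖ q) → P₂ ⊎ P₃)
lemma3p2 M T i j T∈𝒯 i≢j = noneOrTwo , λ X∈ℬ _ → proj₁ noneOrTwo (X∈ℬ , partner X∈ℬ)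
  where
  open AntisymmetricMatroid M

  -- (B2) supplies the partner set.
  partner : ℬ ((T ∪ skewPair i) ∖ skewPair j) → ℬ ((T ∪ skewPair j) ∖ skewPair i)
  partner = proj₁ (B2 T i j T∈𝒯 i≢j)

  orientation : ∀ k → Σ Bool λ b → lookup T k ≡ single b
  orientation = transversal-single T T∈𝒯

  open Embedding i≢j (proj₁ (orientation i)) (proj₁ (orientation j))

  noneOrTwo : NoneOrTwoPairs ℬ T (skewPair i) (skewPair j)
  noneOrTwo =
    noneOrTwo-embed {ℬ} T unstarred (skewPair zero) (skewPair (suc zero))
      (embed-unstarred T (proj₂ (orientation i)) (proj₂ (orientation j)))
      (skewPair-embed zero) (skewPair-embed (suc zero))
      (noneOrTwo-unstarred (exchange-embed T (proj₂ T∈𝒯) Exch))
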